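{- Let $K$ be a cubic number field, $n$ a positive integer, and $\varepsilon, \delta \in \mathcal{O}_K^\times \setminus \mathbb{Q}$ with $\varepsilon + \delta = n$. Write the minimal polynomial of $\delta$ as $x^3 + ax^2 + bx \pm 1$ with $a,b \in \mathbb{Z}$, and suppose $n^3 + an^2 + bn = 0$. Then, after possibly interchanging $\varepsilon$ and $\delta$, there are integers $n_\varepsilon, n_\delta$ with $n = n_\varepsilon + n_\delta$ such that the minimal polynomials of $\varepsilon$ and $\delta$ are $$f_\varepsilon(x) = x^3 - (n+n_\varepsilon)x^2 + n n_\varepsilon x - 1 \quad\text{and}\quad f_\delta(x) = x^3 - (n+n_\delta)x^2 + n n_\delta x + 1.$$ -}

module Defs where

open import Data.Nat using (ℕ; _≤_; _<_)
open import Data.Integer using (ℤ)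
open import Data.Rational using (ℚ; 0ℚ; 1ℚ; _+_; _*_; _-_; -_; _/_)
open import Data.List using (List; []; _∷_; _++_; [_]; length; map)
open import Data.Product using (Σ; _×_; ∃)
open import Relation.Binary.PropositionalEquality using (_≡_; _≢_)
open import Relation.Nullary using (¬_)

-- Polynomials over ℚ, as coefficient lists (constant term first).

ℤ→ℚ : ℤ → ℚ
ℤ→ℚ z = z / 1

_+ₚ_ : List ℚ → List ℚ → List ℚ
[]       +ₚ q        = q
(a ∷ p)  +ₚ []       = a ∷ p
(a ∷ p)  +ₚ (b ∷ q)  = (a + b) ∷ (p +ₚ q)

_·ₚ_ : List ℚ → List ℚ → List ℚ
[]      ·ₚ q = []
(a ∷ p) ·ₚ q = map (a *_) q +ₚ (0ℚ ∷ (p ·ₚ q))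

-- A polynomial of exact degree d is written  cs ++ [ lc ]  with
-- length cs = d and leading coefficient lc ≢ 0.

record Cubic : Set where
  constructor cubic
  field
    p q r : ℚ

cubicPoly : Cubic → List ℚ
cubicPoly (cubic p q r) = r ∷ q ∷ p ∷ 1ℚ ∷ []

Irreducible : Cubic → Set
Irreducible g =
  (hs : List ℚ) (hl : ℚ) (ks : List ℚ) (kl : ℚ) →
  hl ≢ 0ℚ → kl ≢ 0ℚ → 1 ≤ length hs → 1 ≤ length ks →
  (hs ++ [ hl ]) ·ₚ (ks ++ [ kl ]) ≢ cubicPoly g

-- The cubic number field  K_g = ℚ[x]/(g)  for g irreducible monic cubic.
-- (Every cubic number field is of this form, by the primitive element
-- theorem.)  An element is  c0 + c1 θ + c2 θ²  where θ is the class of x.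

record K : Set where
  constructor ⟨_,_,_⟩
  field
    c0 c1 c2 : ℚ

ι : ℚ → K
ι a = ⟨ a , 0ℚ , 0ℚ ⟩

0K 1K : K
0K = ι 0ℚ
1K = ι 1ℚ

_⊕_ : K → K → K
⟨ a0 , a1 , a2 ⟩ ⊕ ⟨ b0 , b1 , b2 ⟩ = ⟨ a0 + b0 , a1 + b1 , a2 + b2 ⟩

-- multiplication in ℚ[x]/(g), using θ³ = -pθ² - qθ - r and
-- θ⁴ = (p² - q)θ² + (pq - r)θ + pr.
mulK : Cubic → K → K → K
mulK (cubic p q r) ⟨ a0 , a1 , a2 ⟩ ⟨ b0 , b1 , b2 ⟩ =
  ⟨ d0 - r * d3 + p * r * d4
  , d1 - q * d3 + (p * q - r) * d4
  , d2 - p * d3 + (p * p - q) * d4 ⟩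
  where
  d0 = a0 * b0
  d1 = a0 * b1 + a1 * b0
  d2 = a0 * b2 + a1 * b1 + a2 * b0
  d3 = a1 * b2 + a2 * b1
  d4 = a2 * b2

eval : Cubic → List ℚ → K → K
eval g []       α = 0K
eval g (c ∷ cs) α = ι c ⊕ mulK g α (eval g cs α)

IsAlgInt : Cubic → K → Set
IsAlgInt g α = Σ (List ℤ) λ cs → eval g (map ℤ→ℚ cs ++ [ 1ℚ ]) α ≡ 0K

IsUnit : Cubic → K → Set
IsUnit g α = IsAlgInt g α × Σ K λ β → IsAlgInt g β × mulK g α β ≡ 1K

IsRational : K → Set
IsRational α = Σ ℚ λ a → α ≡ ι a

IsMinPoly : Cubic → K → List ℚ → Set
IsMinPoly g α cs =
  eval g (cs ++ [ 1ℚ ]) α ≡ 0K ×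
  ((ds : List ℚ) (lc : ℚ) → lc ≢ 0ℚ → eval g (ds ++ [ lc ]) α ≡ 0K →
     length cs ≤ length ds)

-- With f = x (x - t) (x - u) + s, one has  - f (t - x) = x (x - t) (x - (t - u)) - s.
-- So if δ has minimal polynomial f, then ε = t - δ is a root of the second cubic, and it is
-- again minimal, because x ↦ t - x turns a low-degree polynomial vanishing at ε into one of
-- the same degree vanishing at δ.  For the theorem, t = n: the hypothesis n³ + a n² + b n = 0
-- with n ≠ 0 says exactly that x³ + a x² + b x ± 1 has the shape x (x - n) (x - m) ± 1 with
-- m = - (a + n), and the two values of the constant term decide which of ε, δ gets - 1.
module Submission where

open import Defs
open import Level using (0ℓ)
open import Data.Nat as ℕ using (ℕ; NonZero; _≤_; z≤n; s≤s; z<s; s<s)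
open import Data.Nat.Properties using (<⇒≱)
import Data.Nat.Coprimality as Coprimality
open import Data.Fin using (#_)
open import Data.Vec using (Vec; []; _∷_)
open import Data.List using (List; []; _∷_; _++_; [_]; length)
open import Data.Product using (Σ; _×_; _,_)
open import Data.Sum using (_⊎_; inj₁; inj₂)
open import Function using (_∘_)
open import Relation.Nullary using (¬_; contradiction)
open import Relation.Nullary.Decidable using (dec⇒maybe)
open import Relation.Binary.PropositionalEquality using (_≡_; _≢_; refl; sym; trans; cong; cong₂; subst; module ≡-Reasoning)
import Data.Integer as ℤ
import Data.Integer.Properties as ℤ
open import Data.Integer.Tactic.RingSolver using (solve-∀)
import Data.Rational as ℚ
import Data.Rational.Properties as ℚ

ℤ→ℚ≡mkℚ : ∀ x → ℤ→ℚ x ≡ ℚ.mkℚ x 0 (Coprimality.sym (Coprimality.1-coprimeTo ℤ.∣ x ∣))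
ℤ→ℚ≡mkℚ x = ℚ.↥p/↧p≡p (ℚ.mkℚ x 0 _)

ℤ→ℚ-homo-+ : ∀ x y → ℤ→ℚ (x ℤ.+ y) ≡ ℤ→ℚ x ℚ.+ ℤ→ℚ y
ℤ→ℚ-homo-+ x y rewrite ℤ→ℚ≡mkℚ x | ℤ→ℚ≡mkℚ y =
  cong (ℚ._/ 1) (sym (cong₂ ℤ._+_ (ℤ.*-identityʳ x) (ℤ.*-identityʳ y)))

ℤ→ℚ-homo-* : ∀ x y → ℤ→ℚ (x ℤ.* y) ≡ ℤ→ℚ x ℚ.* ℤ→ℚ y
ℤ→ℚ-homo-* x y rewrite ℤ→ℚ≡mkℚ x | ℤ→ℚ≡mkℚ y = refl

ℤ→ℚ-homo‿- : ∀ x → ℤ→ℚ (ℤ.- x) ≡ ℚ.- ℤ→ℚ x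
ℤ→ℚ-homo‿- x rewrite ℤ→ℚ≡mkℚ (ℤ.- x) | ℤ→ℚ≡mkℚ x with x
... | ℤ.+ 0      = refl
... | ℤ.+ ℕ.suc _ = refl
... | ℤ.-[1+ _ ] = refl

module MinPolyReflection where

  open import Data.Rational using (ℚ; 0ℚ; 1ℚ; _+_; _*_; _-_; -_; _≟_)
  open import Data.Rational.Properties using (+-*-commutativeRing; +-assoc; +-inverseʳ; +-identityʳ; neg-injective)
  open import Tactic.RingSolver.Core.AlmostCommutativeRing using (AlmostCommutativeRing; fromCommutativeRing)

  infixl 6 _⊖_
  infix 8 ⊝_

  _⊖_ : K → K → K
  ⟨ a0 , a1 , a2 ⟩ ⊖ ⟨ b0 , b1 , b2 ⟩ = ⟨ a0 - b0 , a1 - b1 , a2 - b2 ⟩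

  ⊝_ : K → K
  ⊝ ⟨ a0 , a1 , a2 ⟩ = ⟨ - a0 , - a1 , - a2 ⟩

  p+q-q≡p : ∀ p q → p + q - q ≡ p
  p+q-q≡p p q = begin
    p + q - q    ≡⟨ +-assoc p q (- q) ⟩
    p + (q - q)  ≡⟨ cong (p +_) (+-inverseʳ q) ⟩
    p + 0ℚ       ≡⟨ +-identityʳ p ⟩
    p            ∎
    where open ≡-Reasoning

  x⊕y≡z⇒x≡z⊖y : ∀ {x y z} → x ⊕ y ≡ z → x ≡ z ⊖ y
  x⊕y≡z⇒x≡z⊖y {⟨ a0 , a1 , a2 ⟩} {⟨ b0 , b1 , b2 ⟩} refl
    rewrite p+q-q≡p a0 b0 | p+q-q≡p a1 b1 | p+q-q≡p a2 b2 = refl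

  -- the coefficients of  x (x - t) (x - u) + s
  rootShiftedCubic : ℚ → ℚ → ℚ → List ℚ
  rootShiftedCubic t u s = s ∷ t * u ∷ - (t + u) ∷ []

  -- Identities in K are checked by the ring solver on a syntactic copy of the arithmetic of K.
  module KExpression where

    ℚ-ring : AlmostCommutativeRing 0ℓ 0ℓ
    ℚ-ring = fromCommutativeRing +-*-commutativeRing (λ x → dec⇒maybe (0ℚ ≟ x))

    open import Tactic.RingSolver.NonReflective ℚ-ring public
      using (Expr; Κ; Ι; module Ops)
      renaming (_⊕_ to _+ₑ_; _⊗_ to _*ₑ_; ⊝_ to -ₑ_)
    open Ops using (⟦_⟧; ⟦_⇓⟧; prove)

    infixl 6 _-ₑ_

    _-ₑ_ : ∀ {n} → Expr ℚ n → Expr ℚ n → Expr ℚ n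
    x -ₑ y = x +ₑ (-ₑ y)

    record KExpr (n : ℕ) : Set where
      constructor ⟪_,_,_⟫
      field
        c0 c1 c2 : Expr ℚ n

    ⟦_⟧ᴷ : ∀ {n} → KExpr n → Vec ℚ n → K
    ⟦ ⟪ x0 , x1 , x2 ⟫ ⟧ᴷ ρ = ⟨ ⟦ x0 ⟧ ρ , ⟦ x1 ⟧ ρ , ⟦ x2 ⟧ ρ ⟩

    module _ {n : ℕ} where

      ιₑ : Expr ℚ n → KExpr n
      ιₑ a = ⟪ a , Κ 0ℚ , Κ 0ℚ ⟫

      _⊕ₑ_ _⊖ₑ_ : KExpr n → KExpr n → KExpr n
      ⟪ a0 , a1 , a2 ⟫ ⊕ₑ ⟪ b0 , b1 , b2 ⟫ = ⟪ a0 +ₑ b0 , a1 +ₑ b1 , a2 +ₑ b2 ⟫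
      ⟪ a0 , a1 , a2 ⟫ ⊖ₑ ⟪ b0 , b1 , b2 ⟫ = ⟪ a0 -ₑ b0 , a1 -ₑ b1 , a2 -ₑ b2 ⟫

      ⊝ₑ_ : KExpr n → KExpr n
      ⊝ₑ ⟪ a0 , a1 , a2 ⟫ = ⟪ -ₑ a0 , -ₑ a1 , -ₑ a2 ⟫

      mulₑ : (p q r : Expr ℚ n) → KExpr n → KExpr n → KExpr n
      mulₑ p q r ⟪ a0 , a1 , a2 ⟫ ⟪ b0 , b1 , b2 ⟫ =
        ⟪ d0 -ₑ r *ₑ d3 +ₑ p *ₑ r *ₑ d4
        , d1 -ₑ q *ₑ d3 +ₑ (p *ₑ q -ₑ r) *ₑ d4
        , d2 -ₑ p *ₑ d3 +ₑ (p *ₑ p -ₑ q) *ₑ d4 ⟫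
        where
        d0 = a0 *ₑ b0
        d1 = a0 *ₑ b1 +ₑ a1 *ₑ b0
        d2 = a0 *ₑ b2 +ₑ a1 *ₑ b1 +ₑ a2 *ₑ b0
        d3 = a1 *ₑ b2 +ₑ a2 *ₑ b1
        d4 = a2 *ₑ b2

      evalₑ : (p q r : Expr ℚ n) → List (Expr ℚ n) → KExpr n → KExpr n
      evalₑ p q r []       α = ιₑ (Κ 0ℚ)
      evalₑ p q r (c ∷ cs) α = ιₑ c ⊕ₑ mulₑ p q r α (evalₑ p q r cs α)

      ⟦⟧ᴷ-≡-byNormalisation : ∀ ρ (x y : KExpr n) →
        ⟦ KExpr.c0 x ⇓⟧ ρ ≡ ⟦ KExpr.c0 y ⇓⟧ ρ → ⟦ KExpr.c1 x ⇓⟧ ρ ≡ ⟦ KExpr.c1 y ⇓⟧ ρ →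
        ⟦ KExpr.c2 x ⇓⟧ ρ ≡ ⟦ KExpr.c2 y ⇓⟧ ρ → ⟦ x ⟧ᴷ ρ ≡ ⟦ y ⟧ᴷ ρ
      ⟦⟧ᴷ-≡-byNormalisation ρ ⟪ x0 , x1 , x2 ⟫ ⟪ y0 , y1 , y2 ⟫ e0 e1 e2
        rewrite prove ρ x0 y0 e0 | prove ρ x1 y1 e1 | prove ρ x2 y2 e2 = refl

  module EvalReflection (p q r a0 a1 a2 t : ℚ) where
    open KExpression

    private
      g : Cubic
      g = cubic p q r

      α : K
      α = ⟨ a0 , a1 , a2 ⟩

      ρ : ℚ → ℚ → ℚ → Vec ℚ 10
      ρ c0 c1 c2 = p ∷ q ∷ r ∷ a0 ∷ a1 ∷ a2 ∷ t ∷ c0 ∷ c1 ∷ c2 ∷ []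

      P Q R A0 A1 A2 T C0 C1 C2 : Expr ℚ 10
      P = Ι (# 0)
      Q = Ι (# 1)
      R = Ι (# 2)
      A0 = Ι (# 3)
      A1 = Ι (# 4)
      A2 = Ι (# 5)
      T = Ι (# 6)
      C0 = Ι (# 7)
      C1 = Ι (# 8)
      C2 = Ι (# 9)

      αₑ t⊖αₑ : KExpr 10
      αₑ = ⟪ A0 , A1 , A2 ⟫
      t⊖αₑ = ιₑ T ⊖ₑ αₑ

      eval′ : List (Expr ℚ 10) → KExpr 10 → KExpr 10
      eval′ = evalₑ P Q R

    eval-reflect₀ : ∀ c0 → eval g (c0 ∷ []) (ι t ⊖ α) ≡ eval g (c0 ∷ []) α
    eval-reflect₀ c0 = ⟦⟧ᴷ-≡-byNormalisation (ρ c0 0ℚ 0ℚ)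
      (eval′ (C0 ∷ []) t⊖αₑ) (eval′ (C0 ∷ []) αₑ) refl refl refl

    eval-reflect₁ : ∀ c0 c1 → eval g (c0 ∷ c1 ∷ []) (ι t ⊖ α) ≡ eval g (c0 + c1 * t ∷ - c1 ∷ []) α
    eval-reflect₁ c0 c1 = ⟦⟧ᴷ-≡-byNormalisation (ρ c0 c1 0ℚ)
      (eval′ (C0 ∷ C1 ∷ []) t⊖αₑ) (eval′ (C0 +ₑ C1 *ₑ T ∷ -ₑ C1 ∷ []) αₑ) refl refl refl

    eval-reflect₂ : ∀ c0 c1 c2 →
      eval g (c0 ∷ c1 ∷ c2 ∷ []) (ι t ⊖ α) ≡ eval g (c0 + c1 * t + c2 * t * t ∷ - (c1 + c2 * t + c2 * t) ∷ c2 ∷ []) α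
    eval-reflect₂ c0 c1 c2 = ⟦⟧ᴷ-≡-byNormalisation (ρ c0 c1 c2)
      (eval′ (C0 ∷ C1 ∷ C2 ∷ []) t⊖αₑ)
      (eval′ (C0 +ₑ C1 *ₑ T +ₑ C2 *ₑ T *ₑ T ∷ -ₑ (C1 +ₑ C2 *ₑ T +ₑ C2 *ₑ T) ∷ C2 ∷ []) αₑ) refl refl refl

    eval-reflect-rootShiftedCubic : ∀ u s →
      eval g (rootShiftedCubic t (t - u) (- s) ++ [ 1ℚ ]) (ι t ⊖ α) ≡ ⊝ eval g (rootShiftedCubic t u s ++ [ 1ℚ ]) α
    eval-reflect-rootShiftedCubic u s = ⟦⟧ᴷ-≡-byNormalisation (ρ s u 0ℚ)
      (eval′ (-ₑ C0 ∷ T *ₑ (T -ₑ C1) ∷ -ₑ (T +ₑ (T -ₑ C1)) ∷ Κ 1ℚ ∷ []) t⊖αₑ)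
      (⊝ₑ eval′ (C0 ∷ T *ₑ C1 ∷ -ₑ (T +ₑ C1) ∷ Κ 1ℚ ∷ []) αₑ) refl refl refl

  minPoly-reflect : ∀ g α t u s → IsMinPoly g α (rootShiftedCubic t u s) →
                    IsMinPoly g (ι t ⊖ α) (rootShiftedCubic t (t - u) (- s))
  minPoly-reflect (cubic p q r) α@(⟨ a0 , a1 , a2 ⟩) t u s (root , minimal) = root′ , minimal′
    where
    open EvalReflection p q r a0 a1 a2 t

    root′ : eval (cubic p q r) (rootShiftedCubic t (t - u) (- s) ++ [ 1ℚ ]) (ι t ⊖ α) ≡ 0K
    root′ = trans (eval-reflect-rootShiftedCubic u s) (cong ⊝_ root)

    minimal′ : ∀ ds lc → lc ≢ 0ℚ → eval (cubic p q r) (ds ++ [ lc ]) (ι t ⊖ α) ≡ 0K → 3 ≤ length ds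
    minimal′ [] lc lc≢0 vanishes = contradiction
      (minimal [] lc lc≢0 (trans (sym (eval-reflect₀ lc)) vanishes))
      (<⇒≱ z<s)
    minimal′ (c0 ∷ []) lc lc≢0 vanishes = contradiction
      (minimal (c0 + lc * t ∷ []) (- lc) (lc≢0 ∘ neg-injective) (trans (sym (eval-reflect₁ c0 lc)) vanishes))
      (<⇒≱ (s<s z<s))
    minimal′ (c0 ∷ c1 ∷ []) lc lc≢0 vanishes = contradiction
      (minimal (c0 + c1 * t + lc * t * t ∷ - (c1 + lc * t + lc * t) ∷ []) lc lc≢0
               (trans (sym (eval-reflect₂ c0 c1 lc)) vanishes))
      (<⇒≱ (s<s (s<s z<s)))
    minimal′ (_ ∷ _ ∷ _ ∷ _) _ _ _ = s≤s (s≤s (s≤s z≤n))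

open MinPolyReflection using (_⊖_; x⊕y≡z⇒x≡z⊖y; rootShiftedCubic; minPoly-reflect)
open import Data.Integer using (ℤ; +_; -_; _+_; _-_; _*_; _^_; 0ℤ; 1ℤ; -1ℤ)

private
  u′≡u′+u-u : ∀ u u′ → u′ ≡ u′ + u - u
  u′≡u′+u-u = solve-∀

  x≡[x-m]+m : ∀ x m → x ≡ (x - m) + m
  x≡[x-m]+m = solve-∀

  b≡[x²+ax+b]+x*-[a+x] : ∀ x a b → b ≡ (x * x + a * x + b) + x * - (a + x)
  b≡[x²+ax+b]+x*-[a+x] = solve-∀

  -- x ^ 3 and x ^ 2 unfolded, since the solver does not recognise ℤ's _^_
  x*[x²+ax+b]≡x³+ax²+bx : ∀ x a b → x * (x * x + a * x + b) ≡ x * (x * (x * 1ℤ)) + a * (x * (x * 1ℤ)) + b * x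
  x*[x²+ax+b]≡x³+ax²+bx = solve-∀

  a≡-[x+-[a+x]] : ∀ x a → a ≡ - (x + - (a + x))
  a≡-[x+-[a+x]] = solve-∀

rootShiftedCubicℤ : ℤ → ℤ → ℤ → List ℚ.ℚ
rootShiftedCubicℤ t u s = ℤ→ℚ s ∷ ℤ→ℚ (t * u) ∷ ℤ→ℚ (- (t + u)) ∷ []

rootShiftedCubicℤ≡rootShiftedCubic : ∀ t u s →
  rootShiftedCubicℤ t u s ≡ rootShiftedCubic (ℤ→ℚ t) (ℤ→ℚ u) (ℤ→ℚ s)
rootShiftedCubicℤ≡rootShiftedCubic t u s =
  cong₂ (λ c1 c2 → ℤ→ℚ s ∷ c1 ∷ c2 ∷ [])
        (ℤ→ℚ-homo-* t u)
        (trans (ℤ→ℚ-homo‿- (t + u)) (cong ℚ.-_ (ℤ→ℚ-homo-+ t u)))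

-- The constant term is s′ with s′ ≡ - s rather than - s, so that at the call sites it is
-- literally -1ℤ or 1ℤ: checking - 1ℤ against -1ℤ inside IsMinPoly makes Agda unfold eval.
minPoly-reflectℤ : ∀ g α t u u′ s s′ → t ≡ u′ + u → s′ ≡ - s →
                   IsMinPoly g α (rootShiftedCubicℤ t u s) → IsMinPoly g (ι (ℤ→ℚ t) ⊖ α) (rootShiftedCubicℤ t u′ s′)
minPoly-reflectℤ g α t u u′ s .(- s) t≡u′+u refl minimal =
  subst (IsMinPoly g (ι T ⊖ α)) reflected≡
        (minPoly-reflect g α T (ℤ→ℚ u) (ℤ→ℚ s) (subst (IsMinPoly g α) (rootShiftedCubicℤ≡rootShiftedCubic t u s) minimal))
  where
  T = ℤ→ℚ t
  open ≡-Reasoning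
  T-U≡U′ : T ℚ.- ℤ→ℚ u ≡ ℤ→ℚ u′
  T-U≡U′ = begin
    T ℚ.- ℤ→ℚ u       ≡⟨ cong (T ℚ.+_) (sym (ℤ→ℚ-homo‿- u)) ⟩
    T ℚ.+ ℤ→ℚ (- u)   ≡⟨ sym (ℤ→ℚ-homo-+ t (- u)) ⟩
    ℤ→ℚ (t - u)       ≡⟨ cong (λ t → ℤ→ℚ (t - u)) t≡u′+u ⟩
    ℤ→ℚ (u′ + u - u)  ≡⟨ cong ℤ→ℚ (sym (u′≡u′+u-u u u′)) ⟩
    ℤ→ℚ u′            ∎
  reflected≡ : rootShiftedCubic T (T ℚ.- ℤ→ℚ u) (ℚ.- ℤ→ℚ s) ≡ rootShiftedCubicℤ t u′ (- s)
  reflected≡ = begin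
    rootShiftedCubic T (T ℚ.- ℤ→ℚ u) (ℚ.- ℤ→ℚ s)  ≡⟨ cong₂ (rootShiftedCubic T) T-U≡U′ (sym (ℤ→ℚ-homo‿- s)) ⟩
    rootShiftedCubic T (ℤ→ℚ u′) (ℤ→ℚ (- s))      ≡⟨ sym (rootShiftedCubicℤ≡rootShiftedCubic t u′ (- s)) ⟩
    rootShiftedCubicℤ t u′ (- s)                  ∎

x³+ax²+bx≡0⇒b≡x*-[a+x] : ∀ x a b .{{_ : ℤ.NonZero x}} → x ^ 3 + a * x ^ 2 + b * x ≡ 0ℤ → b ≡ x * - (a + x)
x³+ax²+bx≡0⇒b≡x*-[a+x] x a b cubic≡0 = begin
  b                                   ≡⟨ b≡[x²+ax+b]+x*-[a+x] x a b ⟩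
  (x * x + a * x + b) + x * - (a + x) ≡⟨ cong (_+ x * - (a + x)) quadratic≡0 ⟩
  0ℤ + x * - (a + x)                  ≡⟨ ℤ.+-identityˡ _ ⟩
  x * - (a + x)                       ∎
  where
  open ≡-Reasoning
  quadratic≡0 : x * x + a * x + b ≡ 0ℤ
  quadratic≡0 = ℤ.*-cancelˡ-≡ x _ 0ℤ (trans (x*[x²+ax+b]≡x³+ax²+bx x a b) (trans cubic≡0 (sym (ℤ.*-zeroʳ x))))

minPolys-of-sum : ∀ g (n : ℕ) .{{_ : NonZero n}} ε δ a b s s′ → s′ ≡ - s →
  ε ⊕ δ ≡ ι (ℤ→ℚ (+ n)) →
  IsMinPoly g δ (ℤ→ℚ s ∷ ℤ→ℚ b ∷ ℤ→ℚ a ∷ []) →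
  (+ n) ^ 3 + a * (+ n) ^ 2 + b * (+ n) ≡ 0ℤ →
  Σ ℤ λ mε → Σ ℤ λ mδ → (+ n ≡ mε + mδ) ×
    IsMinPoly g ε (rootShiftedCubicℤ (+ n) mε s′) × IsMinPoly g δ (rootShiftedCubicℤ (+ n) mδ s)
minPolys-of-sum g n ε δ a b s s′ s′≡-s ε⊕δ≡n minδ n-root =
  + n - mδ , mδ , x≡[x-m]+m (+ n) mδ , minε , minδ′
  where
  mδ = - (a + + n)
  minδ′ : IsMinPoly g δ (rootShiftedCubicℤ (+ n) mδ s)
  minδ′ = subst (IsMinPoly g δ)
                (cong₂ (λ b′ a′ → ℤ→ℚ s ∷ ℤ→ℚ b′ ∷ ℤ→ℚ a′ ∷ [])
                       (x³+ax²+bx≡0⇒b≡x*-[a+x] (+ n) a b n-root) (a≡-[x+-[a+x]] (+ n) a))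
                minδ
  ε≡n⊖δ : ε ≡ ι (ℤ→ℚ (+ n)) ⊖ δ
  ε≡n⊖δ = x⊕y≡z⇒x≡z⊖y ε⊕δ≡n
  minε : IsMinPoly g ε (rootShiftedCubicℤ (+ n) (+ n - mδ) s′)
  minε = subst (λ x → IsMinPoly g x (rootShiftedCubicℤ (+ n) (+ n - mδ) s′)) (sym ε≡n⊖δ)
               (minPoly-reflectℤ g δ (+ n) mδ (+ n - mδ) s s′ (x≡[x-m]+m (+ n) mδ) s′≡-s minδ′)

lemma3p2 : (g : Cubic) → Irreducible g →
           (n : ℕ) → .{{_ : NonZero n}} →
           (ε δ : K) → IsUnit g ε → ¬ IsRational ε → IsUnit g δ → ¬ IsRational δ →
           ε ⊕ δ ≡ ι (ℤ→ℚ (+ n)) →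
           (a b s : ℤ) → (s ≡ 1ℤ ⊎ s ≡ -1ℤ) →
           IsMinPoly g δ (ℤ→ℚ s ∷ ℤ→ℚ b ∷ ℤ→ℚ a ∷ []) →
           (+ n) ^ 3 + a * (+ n) ^ 2 + b * (+ n) ≡ 0ℤ →
           Σ ℤ λ nε → Σ ℤ λ nδ → (+ n ≡ nε + nδ) ×
             ((IsMinPoly g ε (ℤ→ℚ -1ℤ ∷ ℤ→ℚ (+ n * nε) ∷ ℤ→ℚ (- (+ n + nε)) ∷ []) ×
               IsMinPoly g δ (ℤ→ℚ 1ℤ ∷ ℤ→ℚ (+ n * nδ) ∷ ℤ→ℚ (- (+ n + nδ)) ∷ []))
             ⊎
              (IsMinPoly g δ (ℤ→ℚ -1ℤ ∷ ℤ→ℚ (+ n * nε) ∷ ℤ→ℚ (- (+ n + nε)) ∷ []) ×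
               IsMinPoly g ε (ℤ→ℚ 1ℤ ∷ ℤ→ℚ (+ n * nδ) ∷ ℤ→ℚ (- (+ n + nδ)) ∷ [])))
lemma3p2 g _ n ε δ _ _ _ _ ε⊕δ≡n a b _ (inj₁ refl) minδ n-root =
  let mε , mδ , n≡mε+mδ , minε , minδ′ = minPolys-of-sum g n ε δ a b 1ℤ -1ℤ refl ε⊕δ≡n minδ n-root
  in  mε , mδ , n≡mε+mδ , inj₁ (minε , minδ′)
lemma3p2 g _ n ε δ _ _ _ _ ε⊕δ≡n a b _ (inj₂ refl) minδ n-root =
  let mε , mδ , n≡mε+mδ , minε , minδ′ = minPolys-of-sum g n ε δ a b -1ℤ 1ℤ refl ε⊕δ≡n minδ n-root
  in  mδ , mε , trans n≡mε+mδ (ℤ.+-comm mε mδ) , inj₂ (minδ′ , minε)
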